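{- Let $N\in\mathbb N$, let $\mathcal U(12N+7)=\{(x,y)\in\mathbb Z^2:x^2+3y^2=12N+7\}$, let $\mathcal B(N)=\{(q_1,q_2)\in\mathbb Z^2:4q_1^2+4q_2^2+4q_1q_2+2q_1+3q_2=N\}$ and $\varphi:\mathcal B(N)\to\mathcal U(12N+7)$, $\varphi(q_1,q_2)=(6q_2+2,\,4q_1+2q_2+1)$. Then: (1) the action of the Klein four-group $V_4$ on $\mathcal U(12N+7)$ is free; (2) $\varphi(\mathcal B(N))$ is a complete set of representatives of the $V_4$-orbits of $\mathcal U(12N+7)$.
   Context: $V_4$ acts on $\mathcal U(k)$ by sign changes: its elements act as $(x,y)\mapsto(x,y),(-x,y),(x,-y),(-x,-y)$. Origin: $4q_1^2+4q_2^2+4q_1q_2+2q_1+3q_2$ is the $\Lambda_0$-atomic length of $q_1\varepsilon_1+q_2\varepsilon_2+q_3\varepsilon_3$ with $q_3=-q_1-q_2$ in the lattice $M$ of type $D_4^{(3)}$. -}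

module Defs where

open import Data.Nat using (ℕ)
open import Data.Integer using (ℤ; +_; -_; _+_; _*_)
open import Data.Product using (_×_; _,_; Σ; ∃; ∃-syntax)
open import Relation.Binary.PropositionalEquality using (_≡_; _≢_)

Pt : Set
Pt = ℤ × ℤ

InU : ℤ → Pt → Set
InU k (x , y) = x * x + + 3 * (y * y) ≡ k

InB : ℕ → Pt → Set
InB N (q₁ , q₂) =
  + 4 * (q₁ * q₁) + + 4 * (q₂ * q₂) + + 4 * (q₁ * q₂) + + 2 * q₁ + + 3 * q₂ ≡ + N

φ : Pt → Pt
φ (q₁ , q₂) = (+ 6 * q₂ + + 2 , + 4 * q₁ + + 2 * q₂ + + 1)

data V4 : Set where
  e a b ab : V4

act : V4 → Pt → Pt
act e  (x , y) = (x , y)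
act a  (x , y) = (- x , y)
act b  (x , y) = (x , - y)
act ab (x , y) = (- x , - y)

FreeOn : ℤ → Set
FreeOn k = ∀ (g : V4) (p : Pt) → InU k p → act g p ≡ p → g ≡ e

SameOrbit : Pt → Pt → Set
SameOrbit p q = ∃[ g ] act g p ≡ q

InImage : ℕ → Pt → Set
InImage N p = ∃[ q ] (InB N q × φ q ≡ p)

CompleteReps : ℕ → ℤ → Set
CompleteReps N k =
  (∀ p → InImage N p → InU k p)
  × (∀ u → InU k u → ∃[ p ] (InImage N p × SameOrbit p u))
  × (∀ p p′ → InImage N p → InImage N p′ → SameOrbit p p′ → p ≡ p′)

-- Reducing x² + 3y² = 12N + 7 modulo 12 forces x ≡ ±2 (mod 6) and y odd. Hence no coordinate
-- vanishes, so no sign change fixes a point. After fixing the sign of x we have x = 6k + 2,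
-- and choosing the sign of y we get y ≡ 2k + 1 (mod 4), i.e. (x, y) = φ(q, k); the identity
-- x² + 3y² = 12 B(q, k) + 7 for (x, y) = φ(q, k) shows (q, k) ∈ ℬ(N). Within φ(ℬ(N)) the
-- coordinates satisfy x ≡ 2 (mod 6) and y ≡ 2k + 1 (mod 4), which a nontrivial sign change breaks.
module Submission where

open import Defs
open import Data.Nat using (ℕ)
open import Data.Integer using (+_; _+_; _*_)
open import Data.Product using (_×_)

open import Algebra.Bundles using (AbelianGroup)
open import Data.Empty using (⊥-elim)
open import Data.Integer using (ℤ; -_; _-_; ∣_∣)
open import Data.Integer.DivMod using (_/ℕ_; _%ℕ_; n%ℕd<d; a≡a%ℕn+[a/ℕn]*n)
open import Data.Integer.Properties
  using (abs-*; *-cancelˡ-≡; +-inverseʳ; neg-injective; neg-distribʳ-*; +-0-abelianGroup)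
open import Data.Integer.Tactic.RingSolver using (solve)
open import Data.List using (_∷_; [])
import Data.Nat as ℕ
open import Data.Nat using (s≤s)
open import Data.Nat.DivMod using (m*n%n≡0)
import Data.Nat.Properties as ℕ
open import Data.Product using (∃-syntax; ∃₂; _,_; proj₁; proj₂)
open import Data.Sum using (_⊎_; inj₁; inj₂)
open import Relation.Binary.PropositionalEquality
open import Algebra.Properties.Group (AbelianGroup.group +-0-abelianGroup)
  using (∙-cancelʳ; inverseʳ-unique)
open ≡-Reasoning

∣n*m∣%n≡0 : ∀ n .{{_ : ℕ.NonZero n}} m → ∣ + n * m ∣ ℕ.% n ≡ 0
∣n*m∣%n≡0 n m = begin
  ∣ + n * m ∣ ℕ.% n    ≡⟨ cong (ℕ._% n) (abs-* (+ n) m) ⟩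
  (n ℕ.* ∣ m ∣) ℕ.% n  ≡⟨ cong (ℕ._% n) (ℕ.*-comm n ∣ m ∣) ⟩
  (∣ m ∣ ℕ.* n) ℕ.% n  ≡⟨ m*n%n≡0 ∣ m ∣ n ⟩
  0                    ∎

n*m+r≢0 : ∀ n .{{_ : ℕ.NonZero n}} m r → r ℕ.% n ≢ 0 → + n * m + + r ≢ + 0
n*m+r≢0 n m r r%n≢0 n*m+r≡0 =
  r%n≢0 (subst (λ z → ∣ z ∣ ℕ.% n ≡ 0) (sym r≡n*[-m]) (∣n*m∣%n≡0 n (- m)))
  where
  r≡n*[-m] : + r ≡ + n * - m
  r≡n*[-m] = trans (inverseʳ-unique (+ n * m) (+ r) n*m+r≡0) (neg-distribʳ-* (+ n) m)

u+v≡n*m+r⇒-u≢v : ∀ n .{{_ : ℕ.NonZero n}} m r → r ℕ.% n ≢ 0 →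
               ∀ u v → u + v ≡ + n * m + + r → - u ≢ v
u+v≡n*m+r⇒-u≢v n m r r%n≢0 u v u+v≡n*m+r -u≡v = n*m+r≢0 n m r r%n≢0 (begin
  + n * m + + r  ≡⟨ sym u+v≡n*m+r ⟩
  u + v          ≡⟨ cong (_+_ u) (sym -u≡v) ⟩
  u + - u        ≡⟨ +-inverseʳ u ⟩
  + 0            ∎)

remainder-quotient : ∀ z n .{{_ : ℕ.NonZero n}} → ∃₂ λ r q → r ℕ.< n × z ≡ + r + q * + n
remainder-quotient z n = z %ℕ n , z /ℕ n , n%ℕd<d z n , a≡a%ℕn+[a/ℕn]*n z n

6x+2-injective : ∀ {x y} → + 6 * x + + 2 ≡ + 6 * y + + 2 → x ≡ y
6x+2-injective {x} {y} eq = *-cancelˡ-≡ (+ 6) x y (∙-cancelʳ (+ 2) _ _ eq)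

infix 4 _≡±_
_≡±_ : ℤ → ℤ → Set
x ≡± y = x ≡ y ⊎ x ≡ - y

≡±-≢0 : ∀ {x y} → x ≡± y → y ≢ + 0 → x ≢ + 0
≡±-≢0 (inj₁ refl) y≢0 = y≢0
≡±-≢0 (inj₂ refl) y≢0 = λ -y≡0 → y≢0 (neg-injective -y≡0)

≡±⇒SameOrbit : ∀ {x y X Y} → x ≡± X → y ≡± Y → SameOrbit (X , Y) (x , y)
≡±⇒SameOrbit (inj₁ refl) (inj₁ refl) = e , refl
≡±⇒SameOrbit (inj₂ refl) (inj₁ refl) = a , refl
≡±⇒SameOrbit (inj₁ refl) (inj₂ refl) = b , refl
≡±⇒SameOrbit (inj₂ refl) (inj₂ refl) = ab , refl

-x≡x⇒x≡0 : ∀ {x} → - x ≡ x → x ≡ + 0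
-x≡x⇒x≡0 {+ 0} _ = refl

-x*-x≡x*x : ∀ x → - x * - x ≡ x * x
-x*-x≡x*x x = solve (x ∷ [])

norm : Pt → ℤ
norm (x , y) = x * x + + 3 * (y * y)

norm-act : ∀ g p → norm (act g p) ≡ norm p
norm-act e  _       = refl
norm-act a  (x , y) = cong (λ s → s + + 3 * (y * y)) (-x*-x≡x*x x)
norm-act b  (x , y) = cong (λ s → x * x + + 3 * s) (-x*-x≡x*x y)
norm-act ab (x , y) = cong₂ (λ s t → s + + 3 * t) (-x*-x≡x*x x) (-x*-x≡x*x y)

SameOrbit⇒norm≡ : ∀ {p u} → SameOrbit p u → norm p ≡ norm u
SameOrbit⇒norm≡ {p} (g , g·p≡u) = trans (sym (norm-act g p)) (cong norm g·p≡u)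

B-form : Pt → ℤ
B-form (q₁ , q₂) =
  + 4 * (q₁ * q₁) + + 4 * (q₂ * q₂) + + 4 * (q₁ * q₂) + + 2 * q₁ + + 3 * q₂

norm-φ : ∀ q → norm (φ q) ≡ + 12 * B-form q + + 7
norm-φ (q₁ , q₂) = begin
  norm (φ (q₁ , q₂))                                   ≡⟨⟩
  (+ 6 * q₂ + + 2) * (+ 6 * q₂ + + 2)
    + + 3 * ((+ 4 * q₁ + + 2 * q₂ + + 1) * (+ 4 * q₁ + + 2 * q₂ + + 1))
    ≡⟨ solve (q₁ ∷ q₂ ∷ []) ⟩
  + 12 * (+ 4 * (q₁ * q₁) + + 4 * (q₂ * q₂) + + 4 * (q₁ * q₂) + + 2 * q₁ + + 3 * q₂) + + 7
    ≡⟨⟩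
  + 12 * B-form (q₁ , q₂) + + 7                         ∎

InB⇒InU-φ : ∀ {N} q → InB N q → InU (+ 12 * + N + + 7) (φ q)
InB⇒InU-φ q q∈B = trans (norm-φ q) (cong (λ n → + 12 * n + + 7) q∈B)

InU-φ⇒InB : ∀ {N} q → InU (+ 12 * + N + + 7) (φ q) → InB N q
InU-φ⇒InB {N} q φq∈U = *-cancelˡ-≡ (+ 12) (B-form q) (+ N)
  (∙-cancelʳ (+ 7) _ _ (trans (sym (norm-φ q)) φq∈U))

norm-r+6k-t+2j : ∀ r k t j →
  norm (r + k * + 6 , t + j * + 2)
    ≡ r * r + + 3 * (t * t) + + 12 * (+ 3 * (k * k) + k * r + j * j + j * t)
norm-r+6k-t+2j r k t j = begin
  norm (r + k * + 6 , t + j * + 2)                                       ≡⟨⟩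
  (r + k * + 6) * (r + k * + 6) + + 3 * ((t + j * + 2) * (t + j * + 2))
    ≡⟨ solve (r ∷ k ∷ t ∷ j ∷ []) ⟩
  r * r + + 3 * (t * t) + + 12 * (+ 3 * (k * k) + k * r + j * j + j * t) ∎

norm≡7-mod-12 : ∀ {N} r k t j → InU (+ 12 * N + + 7) (r + k * + 6 , t + j * + 2) →
                ∣ r * r + + 3 * (t * t) - + 7 ∣ ℕ.% 12 ≡ 0
norm≡7-mod-12 {N} r k t j u∈U =
  ≡7-mod-12 {r * r + + 3 * (t * t)} {n = N} (trans (sym (norm-r+6k-t+2j r k t j)) u∈U)
  where
  ≡7-mod-12 : ∀ {s m n} → s + + 12 * m ≡ + 12 * n + + 7 → ∣ s - + 7 ∣ ℕ.% 12 ≡ 0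
  ≡7-mod-12 {s} {m} {n} s+12m≡12n+7 = subst (λ z → ∣ z ∣ ℕ.% 12 ≡ 0) (sym (begin
    s - + 7                            ≡⟨ solve (s ∷ m ∷ []) ⟩
    (s + + 12 * m) - + 12 * m - + 7    ≡⟨ cong (λ z → z - + 12 * m - + 7) s+12m≡12n+7 ⟩
    (+ 12 * n + + 7) - + 12 * m - + 7  ≡⟨ solve (n ∷ m ∷ []) ⟩
    + 12 * (n - m)                     ∎)) (∣n*m∣%n≡0 12 (n - m))

squares-≡7-mod-12 : ∀ r t → r ℕ.< 6 → t ℕ.< 2 →
                    ∣ + r * + r + + 3 * (+ t * + t) - + 7 ∣ ℕ.% 12 ≡ 0 → (r ≡ 2 ⊎ r ≡ 4) × t ≡ 1
squares-≡7-mod-12 2 1 _ _ _ = inj₁ refl , refl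
squares-≡7-mod-12 4 1 _ _ _ = inj₂ refl , refl
squares-≡7-mod-12 0 0 _ _ ()
squares-≡7-mod-12 0 1 _ _ ()
squares-≡7-mod-12 1 0 _ _ ()
squares-≡7-mod-12 1 1 _ _ ()
squares-≡7-mod-12 2 0 _ _ ()
squares-≡7-mod-12 3 0 _ _ ()
squares-≡7-mod-12 3 1 _ _ ()
squares-≡7-mod-12 4 0 _ _ ()
squares-≡7-mod-12 5 0 _ _ ()
squares-≡7-mod-12 5 1 _ _ ()
squares-≡7-mod-12 (ℕ.suc (ℕ.suc (ℕ.suc (ℕ.suc (ℕ.suc (ℕ.suc _)))))) _
  (s≤s (s≤s (s≤s (s≤s (s≤s (s≤s ())))))) _ _
squares-≡7-mod-12 _ (ℕ.suc (ℕ.suc _)) _ (s≤s (s≤s ())) _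

InU-residues : ∀ N x y → InU (+ 12 * N + + 7) (x , y) →
               (∃[ k ] x ≡± + 6 * k + + 2) × (∃[ j ] y ≡ + 2 * j + + 1)
InU-residues N x y u∈U with remainder-quotient x 6 | remainder-quotient y 2
... | r , k , r<6 , refl | t , j , t<2 , refl =
  from-residues k j (squares-≡7-mod-12 r t r<6 t<2 (norm≡7-mod-12 {N} (+ r) k (+ t) j u∈U))
  where
  from-residues : ∀ {r t} k j → (r ≡ 2 ⊎ r ≡ 4) × t ≡ 1 →
    (∃[ k′ ] + r + k * + 6 ≡± + 6 * k′ + + 2) × (∃[ j′ ] + t + j * + 2 ≡ + 2 * j′ + + 1)
  from-residues k j (inj₁ refl , refl) = (k , inj₁ (solve (k ∷ []))) , (j , solve (j ∷ []))
  from-residues k j (inj₂ refl , refl) =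
    (- k - + 1 , inj₂ (solve (k ∷ []))) , (j , solve (j ∷ []))

InU-coordinates≢0 : ∀ N x y → InU (+ 12 * N + + 7) (x , y) → x ≢ + 0 × y ≢ + 0
InU-coordinates≢0 N x y u∈U with InU-residues N x y u∈U
... | (k , x≡±6k+2) , (j , refl) =
  ≡±-≢0 x≡±6k+2 (n*m+r≢0 6 k 2 (λ ())) , n*m+r≢0 2 j 1 (λ ())

free : ∀ N → FreeOn (+ 12 * + N + + 7)
free N g (x , y) u∈U with InU-coordinates≢0 (+ N) x y u∈U
... | x≢0 , y≢0 = only-e g
  where
  only-e : ∀ g → act g (x , y) ≡ (x , y) → g ≡ e
  only-e e  _       = refl
  only-e a  a·u≡u   = ⊥-elim (x≢0 (-x≡x⇒x≡0 (cong proj₁ a·u≡u)))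
  only-e b  b·u≡u   = ⊥-elim (y≢0 (-x≡x⇒x≡0 (cong proj₂ b·u≡u)))
  only-e ab ab·u≡u  = ⊥-elim (x≢0 (-x≡x⇒x≡0 (cong proj₁ ab·u≡u)))

-- y − (2k + 1) = 2 (j − k), so the sign of y has to be flipped exactly when j − k is odd.
odd-≡±-4q+2k+1 : ∀ k j → ∃[ q ] + 2 * j + + 1 ≡± + 4 * q + + 2 * k + + 1
odd-≡±-4q+2k+1 k j = by-parity (remainder-quotient (j - k) 2)
  where
  2j+1≡ : ∀ {d} → j - k ≡ d → + 2 * j + + 1 ≡ + 2 * d + + 2 * k + + 1
  2j+1≡ {d} j-k≡d = begin
    + 2 * j + + 1                  ≡⟨ solve (j ∷ k ∷ []) ⟩
    + 2 * (j - k) + + 2 * k + + 1  ≡⟨ cong (λ d → + 2 * d + + 2 * k + + 1) j-k≡d ⟩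
    + 2 * d + + 2 * k + + 1        ∎

  by-parity : (∃₂ λ r c → r ℕ.< 2 × j - k ≡ + r + c * + 2) →
              ∃[ q ] + 2 * j + + 1 ≡± + 4 * q + + 2 * k + + 1
  by-parity (0 , c , _ , j-k≡2c) = c , inj₁ (begin
    + 2 * j + + 1                          ≡⟨ 2j+1≡ j-k≡2c ⟩
    + 2 * (+ 0 + c * + 2) + + 2 * k + + 1  ≡⟨ solve (c ∷ k ∷ []) ⟩
    + 4 * c + + 2 * k + + 1                ∎)
  by-parity (1 , c , _ , j-k≡2c+1) = - c - k - + 1 , inj₂ (begin
    + 2 * j + + 1                          ≡⟨ 2j+1≡ j-k≡2c+1 ⟩
    + 2 * (+ 1 + c * + 2) + + 2 * k + + 1  ≡⟨ solve (c ∷ k ∷ []) ⟩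
    - (+ 4 * (- c - k - + 1) + + 2 * k + + 1) ∎)
  by-parity (ℕ.suc (ℕ.suc _) , _ , s≤s (s≤s ()) , _)

complete : ∀ N u → InU (+ 12 * + N + + 7) u → ∃[ p ] (InImage N p × SameOrbit p u)
complete N (x , y) u∈U with InU-residues (+ N) x y u∈U
... | (k , x≡±6k+2) , (j , refl) with odd-≡±-4q+2k+1 k j
... | q , y≡±4q+2k+1 =
  φ (q , k) , ((q , k) , InU-φ⇒InB (q , k) (trans (SameOrbit⇒norm≡ orbit) u∈U) , refl) , orbit
  where
  orbit : SameOrbit (φ (q , k)) (x , + 2 * j + + 1)
  orbit = ≡±⇒SameOrbit x≡±6k+2 y≡±4q+2k+1

unique : ∀ N p p′ → InImage N p → InImage N p′ → SameOrbit p p′ → p ≡ p′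
unique N _ _ ((q₁ , q₂) , _ , refl) ((r₁ , r₂) , _ , refl) = λ where
    (e , e·p≡p′)   → e·p≡p′
    (a , a·p≡p′)   → ⊥-elim (x-flip (cong proj₁ a·p≡p′))
    (ab , ab·p≡p′) → ⊥-elim (x-flip (cong proj₁ ab·p≡p′))
    (b , b·p≡p′)   →
      ⊥-elim (y-flip (6x+2-injective (cong proj₁ b·p≡p′)) (cong proj₂ b·p≡p′))
  where
  x-flip : - (+ 6 * q₂ + + 2) ≢ + 6 * r₂ + + 2
  x-flip = u+v≡n*m+r⇒-u≢v 6 (q₂ + r₂) 4 (λ ())
    (+ 6 * q₂ + + 2) (+ 6 * r₂ + + 2) (solve (q₂ ∷ r₂ ∷ []))
  y-flip : q₂ ≡ r₂ → - (+ 4 * q₁ + + 2 * q₂ + + 1) ≢ + 4 * r₁ + + 2 * r₂ + + 1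
  y-flip refl = u+v≡n*m+r⇒-u≢v 4 (q₁ + r₁ + q₂) 2 (λ ())
    (+ 4 * q₁ + + 2 * q₂ + + 1) (+ 4 * r₁ + + 2 * q₂ + + 1) (solve (q₁ ∷ r₁ ∷ q₂ ∷ []))

theorem8p27 : (N : ℕ) → FreeOn (+ 12 * + N + + 7) × CompleteReps N (+ 12 * + N + + 7)
theorem8p27 N = free N , image⊆U , complete N , unique N
  where
  image⊆U : ∀ p → InImage N p → InU (+ 12 * + N + + 7) p
  image⊆U _ (q , q∈B , refl) = InB⇒InU-φ q q∈B
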